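{- Let $\Gamma$ be a bridge/path cubical set, $\Gamma\vdash A$ a discrete type, $\Gamma\vdash P$ a proposition, $\Gamma.P\vdash T$ a discrete type and $\Gamma.P\vdash f:T\to A[\pi]$. Then the glue type $G=\mathrm{Glue}\{A\leftarrow(P\hookrightarrow T,f)\}$ is discrete. (Consequently the CwF of discrete types $\widehat{\mathrm{BPCube}}_{\mathrm{Disc}}$ supports glueing.)
   Context: $\mathrm{BPCube}$: objects pairs $W=(W_B,W_P)$ of disjoint finite sets of names; face maps assign to bridge variables values in $\{0,1\}\cup V_B$ and to path variables values in $\{0,1\}\cup V_B\cup V_P$; composition by substitution. Presheaf CwF notation: $\gamma\varphi$, $T[\gamma]$, $t\langle\varphi\rangle$, $(\Gamma.T)(W)=\{(\gamma,t)\}$, $y$ Yoneda. A proposition is a type with all $P[\gamma]\subseteq\{\star\}$. The glue type: if $P[\gamma]=\{\star\}$ then $G[\gamma]=T[(\gamma,\star)]$ with $T$'s restrictions; if $P[\gamma]=\emptyset$ then $G[\gamma]$ is the set of pairs $(a\mapsfrom t)$ with $a\in A[\gamma]$ and $t$ a term of $T[\gamma{+}]$ over $yW.P[\gamma]$ such that $f[(\gamma\varphi,\star)]\cdot t[(\varphi,\star)] = a\langle\varphi\rangle$ whenever $P[\gamma\varphi]=\{\star\}$; restriction: $(a\mapsfrom t)\langle\varphi\rangle = (a\langle\varphi\rangle\mapsfrom t[\varphi{+}])$ if $P[\gamma\varphi]=\emptyset$ and $=t[(\varphi,\star)]$ if $P[\gamma\varphi]=\{\star\}$. With $(W,i{:}\mathbb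 P)$ and weakening $(\setminus i)$, elements are degenerate in $i$ if they are restrictions along $(\setminus i)$; a type is discrete if every $t\in T[\gamma]$ is degenerate in every path variable in which $\gamma$ is degenerate. -}

module Defs where

open import Data.Nat using (ℕ; suc)
open import Data.Fin using (Fin; punchIn)
open import Data.Vec using (Vec; lookup; map; tabulate)
open import Data.Vec.Properties using (lookup-map; map-∘; map-cong)
open import Data.Bool using (Bool; true; false; _≟_)
open import Data.Product using (Σ; _,_; proj₁; proj₂; _×_)
open import Data.Product.Properties using (Σ-≡,≡→≡)
open import Data.Empty using (⊥; ⊥-elim)
open import Axiom.UniquenessOfIdentityProofs using (module Decidable⇒UIP)
open import Relation.Binary.PropositionalEquality

-- The category BPCube.
-- An object W = (W_B , W_P) is represented by the numbers of bridge
-- and path names; the names themselves are Fin (nb W), Fin (np W).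

record Obj : Set where
  constructor ob
  field
    nb : ℕ
    np : ℕ
open Obj public

-- Bridge variables receive values in Val b 0
-- (= {0,1} ∪ V_B); path variables receive values in Val b p
-- (= {0,1} ∪ V_B ∪ V_P).
data Val (b p : ℕ) : Set where
  v0 v1 : Val b p
  bv : Fin b → Val b p
  pv : Fin p → Val b p

-- A face map φ : V → W assigns values (over V) to the names of W.
record Hom (V W : Obj) : Set where
  constructor hom
  field
    onB : Vec (Val (nb V) 0) (nb W)
    onP : Vec (Val (nb V) (np V)) (np W)
open Hom public

embB : ∀ {b p} → Val b 0 → Val b p
embB v0 = v0
embB v1 = v1
embB (bv j) = bv j

subB : ∀ {U V} → Hom U V → Val (nb V) 0 → Val (nb U) 0
subB ψ v0 = v0
subB ψ v1 = v1
subB ψ (bv j) = lookup (onB ψ) j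

subP : ∀ {U V} → Hom U V → Val (nb V) (np V) → Val (nb U) (np U)
subP ψ v0 = v0
subP ψ v1 = v1
subP ψ (bv j) = embB (lookup (onB ψ) j)
subP ψ (pv j) = lookup (onP ψ) j

idH : ∀ {W} → Hom W W
idH = hom (tabulate bv) (tabulate pv)

_∘H_ : ∀ {U V W} → Hom V W → Hom U V → Hom U W
φ ∘H ψ = hom (map (subB ψ) (onB φ)) (map (subP ψ) (onP φ))

-- weakening (\i) : (W , i:P) → W, for the path name i of (W , i:P)
wk : ∀ {b n} (i : Fin (suc n)) → Hom (ob b (suc n)) (ob b n)
wk i = hom (tabulate bv) (tabulate (λ j → pv (punchIn i j)))

private
  subP-emb : ∀ {U V} (χ : Hom U V) (v : Val (nb V) 0) →
             subP χ (embB v) ≡ embB (subB χ v)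
  subP-emb χ v0 = refl
  subP-emb χ v1 = refl
  subP-emb χ (bv j) = refl

  subB-∘ : ∀ {X U V} (ψ : Hom U V) (χ : Hom X U) (v : Val (nb V) 0) →
           subB χ (subB ψ v) ≡ subB (ψ ∘H χ) v
  subB-∘ ψ χ v0 = refl
  subB-∘ ψ χ v1 = refl
  subB-∘ ψ χ (bv j) = sym (lookup-map j (subB χ) (onB ψ))

  subP-∘ : ∀ {X U V} (ψ : Hom U V) (χ : Hom X U) (v : Val (nb V) (np V)) →
           subP χ (subP ψ v) ≡ subP (ψ ∘H χ) v
  subP-∘ ψ χ v0 = refl
  subP-∘ ψ χ v1 = refl
  subP-∘ ψ χ (bv j) =
    trans (subP-emb χ (lookup (onB ψ) j))
          (cong embB (sym (lookup-map j (subB χ) (onB ψ))))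
  subP-∘ ψ χ (pv j) = sym (lookup-map j (subP χ) (onP ψ))

∘H-assoc : ∀ {X U V W} (φ : Hom V W) (ψ : Hom U V) (χ : Hom X U) →
           φ ∘H (ψ ∘H χ) ≡ (φ ∘H ψ) ∘H χ
∘H-assoc φ ψ χ =
  cong₂ hom
    (trans (sym (map-cong (subB-∘ ψ χ) (onB φ))) (map-∘ (subB χ) (subB ψ) (onB φ)))
    (trans (sym (map-cong (subP-∘ ψ χ) (onP φ))) (map-∘ (subP χ) (subP ψ) (onP φ)))

record CSet : Set₁ where
  field
    Ob : Obj → Set
    _·_ : ∀ {V W} → Ob W → Hom V W → Ob V
    ·-id : ∀ {W} (γ : Ob W) → γ · idH ≡ γ
    ·-∘ : ∀ {U V W} (γ : Ob W) (φ : Hom V W) (ψ : Hom U V) →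
          γ · (φ ∘H ψ) ≡ (γ · φ) · ψ
open CSet public

-- Types over Γ (presheaves over the category of elements of Γ):
-- T[γ] is El W γ, and t⟨φ⟩ is res φ t.
record Ty (Γ : CSet) : Set₁ where
  field
    El : ∀ W → Ob Γ W → Set
    res : ∀ {V W} {γ : Ob Γ W} (φ : Hom V W) → El W γ → El V (_·_ Γ γ φ)
    res-id : ∀ {W} {γ : Ob Γ W} (t : El W γ) →
             subst (El W) (·-id Γ γ) (res idH t) ≡ t
    res-∘ : ∀ {U V W} {γ : Ob Γ W} (φ : Hom V W) (ψ : Hom U V) (t : El W γ) →
            subst (El U) (·-∘ Γ γ φ ψ) (res (φ ∘H ψ) t) ≡ res ψ (res φ t)
open Ty public

_▸_ : (Γ : CSet) → Ty Γ → CSet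
Ob (Γ ▸ T) W = Σ (Ob Γ W) (El T W)
_·_ (Γ ▸ T) γt φ = (_·_ Γ (proj₁ γt) φ , res T φ (proj₂ γt))
·-id (Γ ▸ T) (γ , t) = Σ-≡,≡→≡ (·-id Γ γ , res-id T t)
·-∘ (Γ ▸ T) (γ , t) φ ψ = Σ-≡,≡→≡ (·-∘ Γ γ φ ψ , res-∘ T φ ψ t)

-- Propositions: types with P[γ] ⊆ {⋆}.  P[γ] = {⋆} exactly when
-- holds γ ≡ true (the proof of holds γ ≡ true plays the role of ⋆).
record PropTy (Γ : CSet) : Set where
  field
    holds : ∀ {W} → Ob Γ W → Bool
    mono : ∀ {V W} {γ : Ob Γ W} (φ : Hom V W) →
           holds γ ≡ true → holds (_·_ Γ γ φ) ≡ true
open PropTy public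

uipB : ∀ {b : Bool} (p q : b ≡ true) → p ≡ q
uipB = Decidable⇒UIP.≡-irrelevant _≟_

⟦_⟧ : ∀ {Γ} → PropTy Γ → Ty Γ
El (⟦_⟧ P) W γ = holds P γ ≡ true
res (⟦_⟧ P) φ p = mono P φ p
res-id (⟦_⟧ P) t = uipB _ _
res-∘ (⟦_⟧ P) φ ψ t = uipB _ _

-- Terms Γ.T ⊢ f : T → A[π], i.e. natural families of functions
-- f[(γ,t)] : T[(γ,t)] → A[γ] (f[(γ,⋆)] · t is written  fun f (γ , ⋆) t).
record FunTm (Γ : CSet) (P : PropTy Γ) (T : Ty (Γ ▸ ⟦ P ⟧)) (A : Ty Γ) : Set where
  field
    fun : ∀ {W} (γp : Ob (Γ ▸ ⟦ P ⟧) W) → El T W γp → El A W (proj₁ γp)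
    fun-nat : ∀ {V W} (γp : Ob (Γ ▸ ⟦ P ⟧) W) (φ : Hom V W) (t : El T W γp) →
              fun (_·_ (Γ ▸ ⟦ P ⟧) γp φ) (res T φ t) ≡ res A φ (fun γp t)
open FunTm public

-- Families of "elements with restriction and an equality", the data
-- needed to speak about degeneracy / discreteness.

record Family (Γ : CSet) : Set₁ where
  field
    FEl : ∀ W → Ob Γ W → Set
    fres : ∀ {V W} {γ : Ob Γ W} (φ : Hom V W) → FEl W γ → FEl V (_·_ Γ γ φ)
    _≈_ : ∀ {W} {γ : Ob Γ W} → FEl W γ → FEl W γ → Set
open Family public

fam : ∀ {Γ} → Ty Γ → Family Γ
FEl (fam T) = El T
fres (fam T) = res T
_≈_ (fam T) = _≡_

-- Discreteness: whenever γ is degenerate in the path variable i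
-- (γ = δ⟨\i⟩), every t ∈ T[γ] is degenerate in i (t = s⟨\i⟩).
Discrete : ∀ {Γ} → Family Γ → Set
Discrete {Γ} F =
  ∀ {b n} (i : Fin (suc n)) (δ : Ob Γ (ob b n)) (t : FEl F (ob b (suc n)) (_·_ Γ δ (wk i))) →
  Σ (FEl F (ob b n) δ) λ s → _≈_ F (fres F (wk i) s) t

module GlueDef (Γ : CSet) (A : Ty Γ) (P : PropTy Γ) (T : Ty (Γ ▸ ⟦ P ⟧))
               (f : FunTm Γ P T A) where

  ΓP : CSet
  ΓP = Γ ▸ ⟦ P ⟧

  -- total space Γ.P.T, used to compare elements of T over equal indices
  ΓPT : CSet
  ΓPT = ΓP ▸ T

  castT : ∀ {U} {γ₁ γ₂ : Ob Γ U} (e : γ₁ ≡ γ₂) {p₁ : holds P γ₁ ≡ true}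
          {p₂ : holds P γ₂ ≡ true} → El T U (γ₁ , p₁) → El T U (γ₂ , p₂)
  castT refl {p₁} {p₂} t = subst (λ p → El T _ (_ , p)) (uipB p₁ p₂) t

  castT-tot : ∀ {U} {γ₁ γ₂ : Ob Γ U} (e : γ₁ ≡ γ₂) {p₁ : holds P γ₁ ≡ true}
              {p₂ : holds P γ₂ ≡ true} (t : El T U (γ₁ , p₁)) →
              _≡_ {A = Ob ΓPT U} ((γ₁ , p₁) , t) ((γ₂ , p₂) , castT e t)
  castT-tot refl {p₁} {p₂} t with uipB p₁ p₂
  ... | refl = refl

  castT-fun : ∀ {U} {γ₁ γ₂ : Ob Γ U} (e : γ₁ ≡ γ₂) {p₁ : holds P γ₁ ≡ true}
              {p₂ : holds P γ₂ ≡ true} (t : El T U (γ₁ , p₁)) →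
              fun f (γ₂ , p₂) (castT e t) ≡ subst (El A U) e (fun f (γ₁ , p₁) t)
  castT-fun refl {p₁} {p₂} t with uipB p₁ p₂
  ... | refl = refl

  holds∘ : ∀ {U V W} (γ : Ob Γ W) (φ : Hom V W) (ψ : Hom U V) →
           holds P (_·_ Γ (_·_ Γ γ φ) ψ) ≡ true → holds P (_·_ Γ γ (φ ∘H ψ)) ≡ true
  holds∘ γ φ ψ p = subst (λ x → holds P x ≡ true) (sym (·-∘ Γ γ φ ψ)) p

  -- The elements (a ↤ t) of G[γ] when P[γ] = ∅:
  -- t is a term of T[γ+] over yW.P[γ], i.e. it assigns to every
  -- (φ : V → W , ⋆ ∈ P[γφ]) an element of T[(γφ , ⋆)], naturally;
  -- and f[(γφ,⋆)] · t[(φ,⋆)] = a⟨φ⟩.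
  record GlueEl (W : Obj) (γ : Ob Γ W) : Set where
    constructor _↤_∣_∣_
    field
      a : El A W γ
      τ : ∀ {V} (φ : Hom V W) (p : holds P (_·_ Γ γ φ) ≡ true) →
          El T V (_·_ Γ γ φ , p)
      τ-nat : ∀ {U V} (φ : Hom V W) (ψ : Hom U V)
              (p : holds P (_·_ Γ γ φ) ≡ true)
              (p' : holds P (_·_ Γ γ (φ ∘H ψ)) ≡ true) →
              _≡_ {A = Ob ΓPT U} ((_·_ Γ γ (φ ∘H ψ) , p') , τ (φ ∘H ψ) p')
                                 (_·_ ΓPT ((_·_ Γ γ φ , p) , τ φ p) ψ)
      compat : ∀ {V} (φ : Hom V W) (p : holds P (_·_ Γ γ φ) ≡ true) →
               fun f (_·_ Γ γ φ , p) (τ φ p) ≡ res A φ a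
  open GlueEl public

  τ-resp : ∀ {V W} {γ : Ob Γ W} (g : GlueEl W γ) {φ₁ φ₂ : Hom V W} (e : φ₁ ≡ φ₂)
           (p₁ : holds P (_·_ Γ γ φ₁) ≡ true) (p₂ : holds P (_·_ Γ γ φ₂) ≡ true) →
           _≡_ {A = Ob ΓPT V} ((_·_ Γ γ φ₁ , p₁) , τ g φ₁ p₁) ((_·_ Γ γ φ₂ , p₂) , τ g φ₂ p₂)
  τ-resp g refl p₁ p₂ with uipB p₁ p₂
  ... | refl = refl

  restrictGlue : ∀ {V W} {γ : Ob Γ W} (φ : Hom V W) → GlueEl W γ → GlueEl V (_·_ Γ γ φ)
  restrictGlue {V} {W} {γ} φ g = record
    { a = res A φ (a g)
    ; τ = τ'
    ; τ-nat = nat'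
    ; compat = compat'
    }
    where
    τ' : ∀ {U} (ψ : Hom U V) (p : holds P (_·_ Γ (_·_ Γ γ φ) ψ) ≡ true) →
         El T U (_·_ Γ (_·_ Γ γ φ) ψ , p)
    τ' ψ p = castT (·-∘ Γ γ φ ψ) (τ g (φ ∘H ψ) (holds∘ γ φ ψ p))

    nat' : ∀ {X U} (ψ : Hom U V) (χ : Hom X U)
           (p : holds P (_·_ Γ (_·_ Γ γ φ) ψ) ≡ true)
           (p' : holds P (_·_ Γ (_·_ Γ γ φ) (ψ ∘H χ)) ≡ true) →
           _≡_ {A = Ob ΓPT X} ((_·_ Γ (_·_ Γ γ φ) (ψ ∘H χ) , p') , τ' (ψ ∘H χ) p')
                              (_·_ ΓPT ((_·_ Γ (_·_ Γ γ φ) ψ , p) , τ' ψ p) χ)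
    nat' ψ χ p p' =
      trans (sym (castT-tot (·-∘ Γ γ φ (ψ ∘H χ)) (τ g (φ ∘H (ψ ∘H χ)) (holds∘ γ φ (ψ ∘H χ) p'))))
      (trans (τ-resp g (∘H-assoc φ ψ χ) _ (holds∘ γ (φ ∘H ψ) χ (mono P χ (holds∘ γ φ ψ p))))
      (trans (τ-nat g (φ ∘H ψ) χ (holds∘ γ φ ψ p) _)
             (cong (λ z → _·_ ΓPT z χ) (castT-tot (·-∘ Γ γ φ ψ) (τ g (φ ∘H ψ) (holds∘ γ φ ψ p))))))

    compat' : ∀ {U} (ψ : Hom U V) (p : holds P (_·_ Γ (_·_ Γ γ φ) ψ) ≡ true) →
              fun f (_·_ Γ (_·_ Γ γ φ) ψ , p) (τ' ψ p) ≡ res A ψ (res A φ (a g))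
    compat' ψ p =
      trans (castT-fun (·-∘ Γ γ φ ψ) (τ g (φ ∘H ψ) (holds∘ γ φ ψ p)))
      (trans (cong (subst (El A _) (·-∘ Γ γ φ ψ)) (compat g (φ ∘H ψ) (holds∘ γ φ ψ p)))
             (res-∘ A φ ψ (a g)))

  -- G[γ], by cases on whether P[γ] = {⋆} or P[γ] = ∅
  GEl' : ∀ W (γ : Ob Γ W) (b : Bool) → holds P γ ≡ b → Set
  GEl' W γ true e = El T W (γ , e)
  GEl' W γ false e = GlueEl W γ

  GEl : ∀ W → Ob Γ W → Set
  GEl W γ = GEl' W γ (holds P γ) refl

  GRes' : ∀ {V W} {γ : Ob Γ W} (φ : Hom V W) (b : Bool) (e : holds P γ ≡ b)
          (c : Bool) (e' : holds P (_·_ Γ γ φ) ≡ c) →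
          GEl' W γ b e → GEl' V (_·_ Γ γ φ) c e'
  GRes' φ true e true e' t = castT refl (res T φ t)
  GRes' φ true e false e' t = ⊥-elim (f≢t (trans (sym e') (mono P φ e)))
    where
    f≢t : false ≡ true → ⊥
    f≢t ()
  GRes' φ false e true e' g = τ g φ e'
  GRes' φ false e false e' g = restrictGlue φ g

  GRes : ∀ {V W} {γ : Ob Γ W} (φ : Hom V W) → GEl W γ → GEl V (_·_ Γ γ φ)
  GRes {γ = γ} φ = GRes' φ (holds P γ) refl (holds P (_·_ Γ _ φ)) refl

  GEq' : ∀ {W} (γ : Ob Γ W) (b : Bool) (e : holds P γ ≡ b) →
         GEl' W γ b e → GEl' W γ b e → Set
  GEq' γ true e t t' = t ≡ t'
  GEq' {W} γ false e g g' =
    (a g ≡ a g') × (∀ {V} (φ : Hom V W) (p : holds P (_·_ Γ γ φ) ≡ true) → τ g φ p ≡ τ g' φ p)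

  Glue : Family Γ
  FEl Glue = GEl
  fres Glue = GRes
  _≈_ Glue {γ = γ} = GEq' γ (holds P γ) refl

Glue : (Γ : CSet) (A : Ty Γ) (P : PropTy Γ) (T : Ty (Γ ▸ ⟦ P ⟧)) →
       FunTm Γ P T A → Family Γ
Glue Γ A P T f = GlueDef.Glue Γ A P T f

module Submission where

-- Given t ∈ G[δ⟨\i⟩] we seek s ∈ G[δ] with s⟨\i⟩ = t, splitting on whether P
-- holds at δ and at δ⟨\i⟩.  As P is monotone and (\i) has a section
-- (i ↦ 0), these agree.  If P holds, G is T there and T is discrete.  If not,
-- t = (a ↤ τ): discreteness of A descends a, and τ is descended by
-- evaluating it at i = 0.  This is correct because τ does not depend on the
-- value of i: composing with the generic map sending i to a fresh path name
-- 0 gives a point of Γ.P.T over a base degenerate in 0; by discreteness of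
-- T it is degenerate, so all its instantiations 0 ↦ v agree.

open import Defs
open import Data.Nat using (suc)
open import Data.Fin using (Fin; zero; suc; punchIn)
open import Data.Vec using (Vec; lookup; map; tabulate; insertAt; _∷_)
open import Data.Vec.Properties
  using (map-insertAt; tabulate-∘; tabulate∘lookup; lookup∘tabulate; tabulate-cong;
         insertAt-punchIn; map-cong; map-id)
open import Data.Bool using (Bool; true; false)
open import Data.Product using (Σ; _,_; proj₁; proj₂)
open import Data.Product.Properties using (Σ-≡,≡→≡)
open import Data.Product.Properties.WithK using (,-injectiveʳ)
open import Relation.Binary.PropositionalEquality

extend : ∀ {V b n} (i : Fin (suc n)) → Hom V (ob b n) → Val (nb V) (np V) →
         Hom V (ob b (suc n))
extend i φ v = hom (onB φ) (insertAt (onP φ) i v)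

inst : ∀ {V} → Val (nb V) (np V) → Hom V (ob (nb V) (suc (np V)))
inst v = extend zero idH v

map-subB-bv : ∀ {U V} (ψ : Hom U V) → map (subB ψ) (tabulate bv) ≡ onB ψ
map-subB-bv ψ = trans (sym (tabulate-∘ (subB ψ) bv)) (tabulate∘lookup (onB ψ))

insertAt-lookup-punchIn : ∀ {X : Set} {n} (xs : Vec X (suc n)) (i : Fin (suc n)) →
  insertAt (tabulate (λ j → lookup xs (punchIn i j))) i (lookup xs i) ≡ xs
insertAt-lookup-punchIn (x ∷ xs) zero = cong (x ∷_) (tabulate∘lookup xs)
insertAt-lookup-punchIn {n = suc n} (x ∷ xs) (suc i) =
  cong (x ∷_) (insertAt-lookup-punchIn xs i)

wk-extend : ∀ {V b n} (i : Fin (suc n)) (φ : Hom V (ob b n)) v →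
            wk i ∘H extend i φ v ≡ φ
wk-extend i φ v = cong₂ hom (map-subB-bv (extend i φ v))
  (trans (sym (tabulate-∘ (subP (extend i φ v)) (λ j → pv (punchIn i j))))
    (trans (tabulate-cong (insertAt-punchIn (onP φ) i v)) (tabulate∘lookup (onP φ))))

extend-∘ : ∀ {U V b n} (i : Fin (suc n)) (φ : Hom V (ob b n)) v (ψ : Hom U V) →
           extend i φ v ∘H ψ ≡ extend i (φ ∘H ψ) (subP ψ v)
extend-∘ i φ v ψ = cong (hom _) (map-insertAt (subP ψ) v (onP φ) i)

extend-η : ∀ {V b n} (i : Fin (suc n)) (ψ : Hom V (ob b (suc n))) →
           extend i (wk i ∘H ψ) (lookup (onP ψ) i) ≡ ψ
extend-η i ψ = cong₂ hom (map-subB-bv ψ)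
  (trans (cong (λ ps → insertAt ps i (lookup (onP ψ) i))
               (sym (tabulate-∘ (subP ψ) (λ j → pv (punchIn i j)))))
         (insertAt-lookup-punchIn (onP ψ) i))

subB-idH : ∀ {W} (x : Val (nb W) 0) → subB (idH {W}) x ≡ x
subB-idH v0 = refl
subB-idH v1 = refl
subB-idH (bv j) = lookup∘tabulate bv j

subP-idH : ∀ {W} (x : Val (nb W) (np W)) → subP (idH {W}) x ≡ x
subP-idH v0 = refl
subP-idH v1 = refl
subP-idH (bv j) = cong embB (lookup∘tabulate bv j)
subP-idH (pv j) = lookup∘tabulate pv j

∘H-identityʳ : ∀ {V W} (φ : Hom V W) → φ ∘H idH ≡ φ
∘H-identityʳ φ = cong₂ hom (trans (map-cong subB-idH (onB φ)) (map-id (onB φ)))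
                           (trans (map-cong subP-idH (onP φ)) (map-id (onP φ)))

-- The generic extension of φ: i goes to the fresh path name 0.  Every
-- extension of φ is an instance of it.
generic : ∀ {V b n} (i : Fin (suc n)) → Hom V (ob b n) →
          Hom (ob (nb V) (suc (np V))) (ob b (suc n))
generic i φ = extend i (φ ∘H wk zero) (pv zero)

generic-inst : ∀ {V b n} (i : Fin (suc n)) (φ : Hom V (ob b n)) v →
               generic i φ ∘H inst v ≡ extend i φ v
generic-inst i φ v = trans (extend-∘ i (φ ∘H wk zero) (pv zero) (inst v))
  (cong (λ χ → extend i χ v)
    (trans (sym (∘H-assoc φ (wk zero) (inst v)))
      (trans (cong (φ ∘H_) (wk-extend zero idH v)) (∘H-identityʳ φ))))

·-wk-extend : ∀ (Δ : CSet) {V b n} (δ : Ob Δ (ob b n)) (i : Fin (suc n))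
              (φ : Hom V (ob b n)) v →
              _·_ Δ (_·_ Δ δ (wk i)) (extend i φ v) ≡ _·_ Δ δ φ
·-wk-extend Δ δ i φ v =
  trans (sym (·-∘ Δ δ (wk i) (extend i φ v))) (cong (_·_ Δ δ) (wk-extend i φ v))

degenerate-point : ∀ {Δ : CSet} {T : Ty Δ} → Discrete (fam T) →
  ∀ {b n} (i : Fin (suc n)) (x : Ob Δ (ob b n)) (z : Ob (Δ ▸ T) (ob b (suc n))) →
  proj₁ z ≡ _·_ Δ x (wk i) → Σ (El T (ob b n) x) λ s → z ≡ _·_ (Δ ▸ T) (x , s) (wk i)
degenerate-point discT i x (_ , t) refl =
  proj₁ (discT i x t) , cong (_ ,_) (sym (proj₂ (discT i x t)))

instances-agree : ∀ {Δ : CSet} {T : Ty Δ} → Discrete (fam T) →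
  ∀ {V} (x : Ob Δ V) (z : Ob (Δ ▸ T) (ob (nb V) (suc (np V)))) →
  proj₁ z ≡ _·_ Δ x (wk zero) → (v v' : Val (nb V) (np V)) →
  _·_ (Δ ▸ T) z (inst v) ≡ _·_ (Δ ▸ T) z (inst v')
instances-agree {Δ} {T} discT {V} x z base v v' = trans (collapse v) (sym (collapse v'))
  where
  s : El T _ x
  s = proj₁ (degenerate-point {Δ} {T} discT {nb V} zero x z base)

  collapse : ∀ u → _·_ (Δ ▸ T) z (inst u) ≡ (x , s)
  collapse u = begin
    _·_ (Δ ▸ T) z (inst u)
      ≡⟨ cong (λ y → _·_ (Δ ▸ T) y (inst u)) (proj₂ (degenerate-point {Δ} {T} discT {nb V} zero x z base)) ⟩
    _·_ (Δ ▸ T) (_·_ (Δ ▸ T) (x , s) (wk zero)) (inst u)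
      ≡⟨ ·-wk-extend (Δ ▸ T) (x , s) zero idH u ⟩
    _·_ (Δ ▸ T) (x , s) idH
      ≡⟨ ·-id (Δ ▸ T) (x , s) ⟩
    (x , s) ∎
    where open ≡-Reasoning

module GlueDescent (Γ : CSet) (A : Ty Γ) (P : PropTy Γ) (T : Ty (Γ ▸ ⟦ P ⟧))
                   (f : FunTm Γ P T A) (discA : Discrete (fam A))
                   (discT : Discrete (fam T)) where
  open GlueDef Γ A P T f

  _⋆_ : ∀ {V W} → Ob Γ W → Hom V W → Ob Γ V
  γ ⋆ φ = _·_ Γ γ φ

  transport-holds : ∀ {U} {x y : Ob Γ U} → x ≡ y → holds P x ≡ true → holds P y ≡ true
  transport-holds e = subst (λ z → holds P z ≡ true) e

  ΓP-≡ : ∀ {U} {x y : Ob Γ U} {p q} → x ≡ y → _≡_ {A = Ob ΓP U} (x , p) (y , q)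
  ΓP-≡ {p = p} {q} refl = cong (_ ,_) (uipB p q)

  point : ∀ {V W} {γ : Ob Γ W} → GlueEl W γ → (ψ : Hom V W) →
          holds P (γ ⋆ ψ) ≡ true → Ob ΓPT V
  point {γ = γ} g ψ p = ((γ ⋆ ψ , p) , τ g ψ p)

  module _ {b n} (i : Fin (suc n)) (δ : Ob Γ (ob b n)) where

    -- P holds at δ as soon as it holds at δ⟨\i⟩, by restricting along i ↦ 0.
    holds-descends : holds P (δ ⋆ wk i) ≡ true → holds P δ ≡ true
    holds-descends p = transport-holds
      (trans (·-wk-extend Γ δ i idH v0) (·-id Γ δ)) (mono P (extend i idH v0) p)

    τ-constant : ∀ {V} (g : GlueEl (ob b (suc n)) (δ ⋆ wk i)) (φ : Hom V (ob b n))
                 (v v' : Val (nb V) (np V)) p p' →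
                 point g (extend i φ v) p ≡ point g (extend i φ v') p'
    τ-constant {V} g φ v v' p p' =
      trans (via-generic v p)
        (trans (instances-agree {ΓP} {T} discT {V} (δ ⋆ φ , holds-φ) (point g (generic i φ) p-gen)
                                (ΓP-≡ base) v v')
               (sym (via-generic v' p')))
      where
      holds-φ : holds P (δ ⋆ φ) ≡ true
      holds-φ = transport-holds (·-wk-extend Γ δ i φ v) p

      base : (δ ⋆ wk i) ⋆ generic i φ ≡ (δ ⋆ φ) ⋆ wk zero
      base = trans (·-wk-extend Γ δ i (φ ∘H wk zero) (pv zero)) (·-∘ Γ δ φ (wk zero))

      p-gen : holds P ((δ ⋆ wk i) ⋆ generic i φ) ≡ true
      p-gen = transport-holds (sym base) (mono P (wk zero) holds-φ)

      via-generic : ∀ u q → point g (extend i φ u) q ≡ _·_ ΓPT (point g (generic i φ) p-gen) (inst u)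
      via-generic u q =
        trans (τ-resp g (sym (generic-inst i φ u)) q q-gen) (τ-nat g (generic i φ) (inst u) p-gen q-gen)
        where
        q-gen : holds P ((δ ⋆ wk i) ⋆ (generic i φ ∘H inst u)) ≡ true
        q-gen = transport-holds (cong ((δ ⋆ wk i) ⋆_) (sym (generic-inst i φ u))) q

    -- The descended glue element, evaluating the T-component at i = 0.
    module Descent (g : GlueEl (ob b (suc n)) (δ ⋆ wk i)) where
      a₀ : El A (ob b n) δ
      a₀ = proj₁ (discA i δ (a g))

      a₀-lifts : res A (wk i) a₀ ≡ a g
      a₀-lifts = proj₂ (discA i δ (a g))

      at-zero : ∀ {V} (φ : Hom V (ob b n)) → (δ ⋆ wk i) ⋆ extend i φ v0 ≡ δ ⋆ φ
      at-zero φ = ·-wk-extend Γ δ i φ v0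

      lift : ∀ {V} (φ : Hom V (ob b n)) → holds P (δ ⋆ φ) ≡ true →
             holds P ((δ ⋆ wk i) ⋆ extend i φ v0) ≡ true
      lift φ = transport-holds (sym (at-zero φ))

      τ₀ : ∀ {V} (φ : Hom V (ob b n)) (p : holds P (δ ⋆ φ) ≡ true) → El T V (δ ⋆ φ , p)
      τ₀ φ p = castT (at-zero φ) (τ g (extend i φ v0) (lift φ p))

      point₀ : ∀ {V} (φ : Hom V (ob b n)) (p : holds P (δ ⋆ φ) ≡ true) →
               point g (extend i φ v0) (lift φ p) ≡ ((δ ⋆ φ , p) , τ₀ φ p)
      point₀ φ p = castT-tot (at-zero φ) (τ g (extend i φ v0) (lift φ p))

      τ₀-nat : ∀ {U V} (φ : Hom V (ob b n)) (ψ : Hom U V) p p' →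
               _≡_ {A = Ob ΓPT U} ((δ ⋆ (φ ∘H ψ) , p') , τ₀ (φ ∘H ψ) p')
                                  (_·_ ΓPT ((δ ⋆ φ , p) , τ₀ φ p) ψ)
      τ₀-nat φ ψ p p' =
        trans (sym (point₀ (φ ∘H ψ) p'))
          (trans (τ-resp g (sym (extend-∘ i φ v0 ψ)) _ q)
            (trans (τ-nat g (extend i φ v0) ψ _ q) (cong (λ z → _·_ ΓPT z ψ) (point₀ φ p))))
        where
        q : holds P ((δ ⋆ wk i) ⋆ (extend i φ v0 ∘H ψ)) ≡ true
        q = transport-holds (cong ((δ ⋆ wk i) ⋆_) (sym (extend-∘ i φ v0 ψ))) (lift (φ ∘H ψ) p')

      τ₀-compat : ∀ {V} (φ : Hom V (ob b n)) (p : holds P (δ ⋆ φ) ≡ true) →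
                  fun f (δ ⋆ φ , p) (τ₀ φ p) ≡ res A φ a₀
      τ₀-compat {V} φ p = ,-injectiveʳ (begin
        (δ ⋆ φ , fun f (δ ⋆ φ , p) (τ₀ φ p))
          ≡⟨ cong (δ ⋆ φ ,_) (castT-fun (at-zero φ) (τ g E p₁)) ⟩
        (δ ⋆ φ , subst (El A _) (at-zero φ) (fun f ((δ ⋆ wk i) ⋆ E , p₁) (τ g E p₁)))
          ≡⟨ sym (Σ-≡,≡→≡ (at-zero φ , refl)) ⟩
        ((δ ⋆ wk i) ⋆ E , fun f ((δ ⋆ wk i) ⋆ E , p₁) (τ g E p₁))
          ≡⟨ cong ((δ ⋆ wk i) ⋆ E ,_) (trans (compat g E p₁) (cong (res A E) (sym a₀-lifts))) ⟩
        _·_ (Γ ▸ A) (_·_ (Γ ▸ A) (δ , a₀) (wk i)) E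
          ≡⟨ ·-wk-extend (Γ ▸ A) (δ , a₀) i φ v0 ⟩
        (δ ⋆ φ , res A φ a₀) ∎)
        where
        open ≡-Reasoning
        E : Hom V (ob b (suc n))
        E = extend i φ v0
        p₁ : holds P ((δ ⋆ wk i) ⋆ E) ≡ true
        p₁ = lift φ p

      descended : GlueEl (ob b n) δ
      descended = a₀ ↤ τ₀ ∣ τ₀-nat ∣ τ₀-compat

      -- Restricting back along (\i) recovers g's T-component, since it is
      -- constant in i.
      descended-τ : ∀ {V} (ψ : Hom V (ob b (suc n))) (p : holds P ((δ ⋆ wk i) ⋆ ψ) ≡ true) →
                    τ (restrictGlue (wk i) descended) ψ p ≡ τ g ψ p
      descended-τ ψ p = ,-injectiveʳ
        (trans (sym (castT-tot (·-∘ Γ δ (wk i) ψ) (τ₀ (wk i ∘H ψ) h)))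
          (trans (sym (point₀ (wk i ∘H ψ) h))
            (trans (τ-constant g (wk i ∘H ψ) v0 (lookup (onP ψ) i) _ q)
                   (τ-resp g (extend-η i ψ) q p))))
        where
        h : holds P (δ ⋆ (wk i ∘H ψ)) ≡ true
        h = holds∘ δ (wk i) ψ p
        q : holds P ((δ ⋆ wk i) ⋆ extend i (wk i ∘H ψ) (lookup (onP ψ) i)) ≡ true
        q = transport-holds (cong ((δ ⋆ wk i) ⋆_) (sym (extend-η i ψ))) p

    descend : (c : Bool) (e : holds P δ ≡ c) (d : Bool) (e' : holds P (δ ⋆ wk i) ≡ d)
              (t : GEl' _ (δ ⋆ wk i) d e') →
              Σ (GEl' _ δ c e) λ s → GEq' (δ ⋆ wk i) d e' (GRes' (wk i) c e d e' s) t
    -- Identifying the two proofs of P at δ⟨\i⟩ makes the restriction plain res T.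
    descend true e true e' t with uipB (mono P (wk i) e) e'
    ... | refl = discT i (δ , e) t
    descend true e false e' t with trans (sym e') (mono P (wk i) e)
    ... | ()
    descend false e true e' t with trans (sym e) (holds-descends e')
    ... | ()
    descend false e false e' g = descended , a₀-lifts , descended-τ
      where open Descent g

lemma4p17 : (Γ : CSet) (A : Ty Γ) (P : PropTy Γ) (T : Ty (Γ ▸ ⟦ P ⟧)) (f : FunTm Γ P T A) →
    Discrete (fam A) → Discrete (fam T) → Discrete (Glue Γ A P T f)
lemma4p17 Γ A P T f discA discT i δ t =
  descend i δ (holds P δ) refl (holds P (_·_ Γ δ (wk i))) refl t
  where open GlueDescent Γ A P T f discA discT
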